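{- Let $G$ be a finite graph that is a cograph and a C-I graph and is not a complete graph, and let $T$ be its cotree. Then: (i) the root of $T$ (a $1$-node) has only leaves and $0$-nodes as children, and the number of its $0$-node children is at most the number of its leaf children; (ii) every $0$-node of $T$ has exactly two children (each of which is a $1$-node or a leaf); (iii) every $1$-node of $T$ other than the root has only leaves as children; (iv) $T$ belongs to the family $\mathcal{T}_C$.
   Context: A cograph is a graph with no induced path on four vertices. For a finite poset $P=(V,\le)$, write $u\lhd v$ if $u<v$ and no $w$ satisfies $u<w<v$, and $u\,\|\,v$ if $u,v$ are incomparable; the C-I graph $G_P$ has vertex set $V$ with $uv$ an edge iff $u\lhd v$, $v\lhd u$, or $u\,\|\,v$; a graph is a C-I graph if isomorphic to some $G_P$. The cotree of a cograph $G$ is the unique rooted tree whose leaves are the vertices of $G$, whose internal nodes are labelled $0$ or $1$, in which labels alternate along every root-to-leaf path and every internal node has at least two children, and such that two vertices $x,y$ are adjacent in $G$ iff their lowest common ancestor is labelled $1$ (a $1$-node); for connected $G$ with at least two vertices the root is a $1$-node. $\mathcal{T}_C$ denotes the family of rooted trees $T$ such that either $T$ is a single leaf, or the root of $T$ is a $1$-node whose children are leaves and $0$-nodes with the number of $0$-node children at most the number of leaf children, every $0$-node has exactly two children each of which is a leaf or a $1$-node, and every non-root $1$-node has only leaves as children. -}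

module Defs where

open import Data.Nat using (ℕ; zero; suc; _≤_)
open import Data.Fin using (Fin)
open import Data.Bool using (Bool; true; false; not)
open import Data.List using (List; []; _∷_; _++_; length; lookup)
open import Data.List.Membership.Propositional using (_∈_)
open import Data.List.Relation.Unary.All using (All)
open import Data.List.Relation.Unary.Unique.Propositional using (Unique)
open import Data.Product using (Σ; _×_; _,_; ∃)
open import Data.Sum using (_⊎_)
open import Data.Unit using (⊤)
open import Data.Empty using (⊥)
open import Relation.Nullary using (¬_)
open import Relation.Binary.PropositionalEquality using (_≡_)
open import Relation.Binary.Structures using (IsPartialOrder)
open import Function.Bundles using (_⤖_; Bijection)

record Graph (n : ℕ) : Set₁ where
  field
    Adj    : Fin n → Fin n → Set
    sym    : ∀ {x y} → Adj x y → Adj y x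
    irrefl : ∀ {x} → ¬ Adj x x

module _ {n : ℕ} (G : Graph n) where
  open Graph G

  IsComplete : Set
  IsComplete = ∀ x y → ¬ x ≡ y → Adj x y

  IsInducedP4 : Fin n → Fin n → Fin n → Fin n → Set
  IsInducedP4 a b c d =
    (¬ a ≡ b) × (¬ a ≡ c) × (¬ a ≡ d) × (¬ b ≡ c) × (¬ b ≡ d) × (¬ c ≡ d) ×
    Adj a b × Adj b c × Adj c d × (¬ Adj a c) × (¬ Adj b d) × (¬ Adj a d)

  IsCograph : Set
  IsCograph = ∀ a b c d → ¬ IsInducedP4 a b c d

record FinPoset (m : ℕ) : Set₁ where
  field
    _≤ₚ_           : Fin m → Fin m → Set
    isPartialOrder : IsPartialOrder _≡_ _≤ₚ_

module _ {m : ℕ} (P : FinPoset m) where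
  open FinPoset P

  _<ₚ_ : Fin m → Fin m → Set
  u <ₚ v = (u ≤ₚ v) × ¬ (u ≡ v)

  Covers : Fin m → Fin m → Set
  Covers u v = (u <ₚ v) × ¬ (Σ (Fin m) λ w → (u <ₚ w) × (w <ₚ v))

  Incomparable : Fin m → Fin m → Set
  Incomparable u v = ¬ (u ≤ₚ v) × ¬ (v ≤ₚ u)

  CIEdge : Fin m → Fin m → Set
  CIEdge u v = Covers u v ⊎ Covers v u ⊎ Incomparable u v

IsCIGraph : {n : ℕ} → Graph n → Set₁
IsCIGraph {n} G =
  Σ ℕ λ m → Σ (FinPoset m) λ P → Σ (Fin n ⤖ Fin m) λ f →
    ∀ x y → (Graph.Adj G x y → CIEdge P (Bijection.to f x) (Bijection.to f y))
          × (CIEdge P (Bijection.to f x) (Bijection.to f y) → Graph.Adj G x y)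

-- Rooted trees with leaves labelled in A and internal nodes labelled
-- by a Bool (true = 1-node, false = 0-node)

data Tree (A : Set) : Set where
  leaf : A → Tree A
  node : Bool → List (Tree A) → Tree A

module _ {A : Set} where

  leaves  : Tree A → List A
  leavesL : List (Tree A) → List A
  leaves (leaf x)    = x ∷ []
  leaves (node _ ts) = leavesL ts
  leavesL []       = []
  leavesL (t ∷ ts) = leaves t ++ leavesL ts

  AltChild : Bool → Tree A → Set
  AltChild b (leaf _)    = ⊤
  AltChild b (node c _)  = c ≡ not b

  data CotreeShape : Tree A → Set where
    leaf : ∀ {x} → CotreeShape (leaf x)
    node : ∀ {b ts} → 2 ≤ length ts → All CotreeShape ts → All (AltChild b) ts →
           CotreeShape (node b ts)

  -- LCA x y T b : the lowest common ancestor of leaves x, y in T is a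
  -- node labelled b (the node at which x and y lie in different children)
  data LCA (x y : A) : Tree A → Bool → Set where
    here  : ∀ {b ts} (i j : Fin (length ts)) → ¬ i ≡ j →
            x ∈ leaves (lookup ts i) → y ∈ leaves (lookup ts j) →
            LCA x y (node b ts) b
    there : ∀ {b c ts} (i : Fin (length ts)) → LCA x y (lookup ts i) c →
            LCA x y (node b ts) c

  data _⊑_ : Tree A → Tree A → Set where
    self  : ∀ {t} → t ⊑ t
    child : ∀ {s t b ts} → t ∈ ts → s ⊑ t → s ⊑ node b ts

  data _⊏_ : Tree A → Tree A → Set where
    child : ∀ {s t b ts} → t ∈ ts → s ⊑ t → s ⊏ node b ts

  IsLeaf : Tree A → Set
  IsLeaf (leaf _)   = ⊤
  IsLeaf (node _ _) = ⊥

  IsNodeWith : Bool → Tree A → Set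
  IsNodeWith b (leaf _)   = ⊥
  IsNodeWith b (node c _) = c ≡ b

  numLeaves : List (Tree A) → ℕ
  numLeaves []                = 0
  numLeaves (leaf _ ∷ ts)     = suc (numLeaves ts)
  numLeaves (node _ _ ∷ ts)   = numLeaves ts

  numZeroNodes : List (Tree A) → ℕ
  numZeroNodes []                  = 0
  numZeroNodes (leaf _ ∷ ts)       = numZeroNodes ts
  numZeroNodes (node false _ ∷ ts) = suc (numZeroNodes ts)
  numZeroNodes (node true _ ∷ ts)  = numZeroNodes ts

  LeafOrLeafy1 : Tree A → Set
  LeafOrLeafy1 (leaf _)       = ⊤
  LeafOrLeafy1 (node true cs) = All IsLeaf cs
  LeafOrLeafy1 (node false _) = ⊥

  Good0 : Tree A → Set
  Good0 (leaf _)                   = ⊥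
  Good0 (node true _)              = ⊥
  Good0 (node false (a ∷ b ∷ []))  = LeafOrLeafy1 a × LeafOrLeafy1 b
  Good0 (node false _)             = ⊥

  InTC : Tree A → Set
  InTC (leaf _)       = ⊤
  InTC (node false _) = ⊥
  InTC (node true ts) = All (λ t → IsLeaf t ⊎ Good0 t) ts × numZeroNodes ts ≤ numLeaves ts

IsCotreeOf : {n : ℕ} → Graph n → Tree (Fin n) → Set
IsCotreeOf G T =
  CotreeShape T × Unique (leaves T) × (∀ x → x ∈ leaves T) ×
  (∀ x y → ¬ x ≡ y → (Graph.Adj G x y → LCA x y T true) × (LCA x y T true → Graph.Adj G x y))

{-# OPTIONS --safe #-}
-- In a C-I graph G_P two distinct vertices u, v are non-adjacent exactly when
-- they are comparable without covering each other, i.e. separated by some w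
-- with u < w < v. If G_P is a cograph then P has no chain of four elements:
-- refining such a chain along gaps eventually yields a chain of covers, which
-- induces a P4. Consequently a vertex lying strictly between two others has no
-- non-neighbour, and G_P has no three pairwise non-adjacent vertices. In the
-- cotree, vertices whose lowest common ancestor is a 0-node are non-adjacent.
-- This excludes a 0-root, 0-nodes with three children and 0-nodes below a
-- non-root 1-node. Finally, every 0-child c of the root contains leaves a, b
-- with a < w < b for some w, which must be a leaf child of the root; two
-- different 0-children cannot share w, since a leaf of one and a leaf of the
-- other are adjacent. This injection bounds the number of 0-children.
module Submission where

open import Defs
open import Data.Nat using (ℕ; zero; suc; _≤_; _≤?_; s≤s)
open import Data.Nat.Properties using (≤-refl; ≤-trans; ≤-pred)
open import Data.Fin using (Fin; zero; suc; _≟_)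
open import Data.Fin.Properties using (suc-injective; injective⇒≤; sequence)
open import Data.Bool using (Bool; true; false; not)
open import Data.List using (List; []; _∷_; _++_; length; lookup; filter; allFin)
open import Data.List.Properties using (filter-notAll)
open import Data.List.Membership.Propositional using (_∈_)
open import Data.List.Membership.Propositional.Properties
  using (∈-filter⁺; ∈-allFin; ∈-++⁺ˡ; ∈-++⁺ʳ; ∈-++⁻; ∈-lookup)
open import Data.List.Relation.Binary.Disjoint.Propositional using (Disjoint)
open import Data.List.Relation.Unary.Any as Any using (here; there)
open import Data.List.Relation.Unary.Any.Properties using (lookup-index)
open import Data.List.Relation.Unary.All as All using (All; []; _∷_)
open import Data.List.Relation.Unary.All.Properties using (++⁻ˡ; ++⁻ʳ)
open import Data.List.Relation.Unary.AllPairs using ([]; _∷_)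
open import Data.List.Relation.Unary.Unique.Propositional using (Unique)
open import Data.Product using (Σ; _×_; _,_; proj₁; proj₂; ∃; ∃₂)
open import Data.Sum using (_⊎_; inj₁; inj₂) renaming (map to ⊎-map)
open import Data.Unit using (tt)
open import Data.Empty using (⊥; ⊥-elim)
open import Effect.Monad using (RawMonad)
open import Function using (_∘_; id; case_of_)
open import Function.Bundles using (_⤖_; Bijection)
open import Function.Definitions using (Injective)
open import Relation.Nullary using (¬_; yes; no; ¬?)
open import Relation.Nullary.Decidable using (decidable-stable)
open import Relation.Nullary.Negation using (¬¬-Monad; ¬¬-map)
open import Relation.Binary.PropositionalEquality
  using (_≡_; _≢_; refl; sym; trans; cong; isEquivalence)
open import Relation.Binary.Structures using (IsPartialOrder)
import Relation.Binary.Construct.NonStrictToStrict as NonStrictToStrict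

module Order {m : ℕ} (P : FinPoset m) where
  open FinPoset P
  open IsPartialOrder isPartialOrder using (antisym) renaming (refl to ≤ₚ-refl)
  private module Strict = NonStrictToStrict _≡_ _≤ₚ_

  infix 4 _<_
  _<_ : Fin m → Fin m → Set
  _<_ = _<ₚ_ P

  private variable a b c d u v w z : Fin m

  <-trans : a < b → b < c → a < c
  <-trans = Strict.<-trans isPartialOrder

  <-asym : a < b → ¬ b < a
  <-asym = Strict.<-asym antisym

  Gap : Fin m → Fin m → Set
  Gap u v = ∃ λ w → u < w × w < v

  Separated : Fin m → Fin m → Set
  Separated u v = Gap u v ⊎ Gap v u

  gap⇒< : Gap u v → u < v
  gap⇒< (_ , u<w , w<v) = <-trans u<w w<v

  covers-or-gap : u < v → ¬ ¬ (Covers P u v ⊎ Gap u v)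
  covers-or-gap u<v k = k (inj₁ (u<v , k ∘ inj₂))

  gap⇒¬CIEdge : Gap u v → ¬ CIEdge P u v
  gap⇒¬CIEdge gap (inj₁ (_ , no-gap))       = no-gap gap
  gap⇒¬CIEdge gap (inj₂ (inj₁ (v<u , _)))   = <-asym (gap⇒< gap) v<u
  gap⇒¬CIEdge gap (inj₂ (inj₂ (u≰v , _)))   = u≰v (proj₁ (gap⇒< gap))

  ¬CIEdge⇒separated : u ≢ v → ¬ CIEdge P u v → ¬ ¬ Separated u v
  ¬CIEdge⇒separated {u} {v} u≢v ¬edge ¬separated = ¬edge (inj₂ (inj₂ (u≰v , v≰u)))
    where
    u≰v : ¬ u ≤ₚ v
    u≰v u≤v = ¬edge (inj₁ ((u≤v , u≢v) , ¬separated ∘ inj₁))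
    v≰u : ¬ v ≤ₚ u
    v≰u v≤u = ¬edge (inj₂ (inj₁ ((v≤u , u≢v ∘ sym) , ¬separated ∘ inj₂)))

  CIEdge-sym : CIEdge P u v → CIEdge P v u
  CIEdge-sym (inj₁ u⋖v)                   = inj₂ (inj₁ u⋖v)
  CIEdge-sym (inj₂ (inj₁ v⋖u))            = inj₁ v⋖u
  CIEdge-sym (inj₂ (inj₂ (u≰v , v≰u)))    = inj₂ (inj₂ (v≰u , u≰v))

  CIEdge-irrefl : ¬ CIEdge P u u
  CIEdge-irrefl (inj₁ ((_ , u≢u) , _))        = u≢u refl
  CIEdge-irrefl (inj₂ (inj₁ ((_ , u≢u) , _))) = u≢u refl
  CIEdge-irrefl (inj₂ (inj₂ (u≰u , _)))       = u≰u ≤ₚ-refl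

  ciGraph : Graph m
  ciGraph = record { Adj = CIEdge P ; sym = CIEdge-sym ; irrefl = CIEdge-irrefl }

  covers⇒P4 : Covers P a b → Covers P b c → Covers P c d → IsInducedP4 ciGraph a b c d
  covers⇒P4 {a} {b} {c} {d} a⋖b@(a<b , _) b⋖c@(b<c , _) c⋖d@(c<d , _) =
    proj₂ a<b , proj₂ a<c , proj₂ (<-trans a<c c<d) , proj₂ b<c , proj₂ b<d , proj₂ c<d ,
    inj₁ a⋖b , inj₁ b⋖c , inj₁ c⋖d ,
    gap⇒¬CIEdge (b , a<b , b<c) , gap⇒¬CIEdge (c , b<c , c<d) , gap⇒¬CIEdge (b , a<b , b<d)
    where
    a<c = <-trans a<b b<c
    b<d = <-trans b<c c<d

  module Cograph (cograph : IsCograph ciGraph) where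
    private
      remove : Fin m → List (Fin m) → List (Fin m)
      remove c = filter (λ x → ¬? (x ≟ c))

      -- Induction on a list L containing the open interval (a, d): a
      -- non-covering step is refined through its gap into a 4-chain whose
      -- open interval lies in L without c (or b); a chain of covers is a P4.
      no-4-chain-within : ∀ k (L : List (Fin m)) → length L ≤ k → ∀ {a b c d} →
        (∀ {w} → a < w → w < d → w ∈ L) → a < b → b < c → c < d → ⊥
      no-4-chain-within zero [] _ ⊆L a<b b<c c<d = case ⊆L a<b (<-trans b<c c<d) of λ ()
      no-4-chain-within (suc k) L |L|≤1+k {a} {b} {c} {d} ⊆L a<b b<c c<d =
        covers-or-gap a<b λ where
          (inj₂ (b′ , a<b′ , b′<b)) → within-L∖c a<b′ b′<b b<c
          (inj₁ a⋖b) → covers-or-gap b<c λ where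
            (inj₂ (c′ , b<c′ , c′<c)) → within-L∖c a<b b<c′ c′<c
            (inj₁ b⋖c) → covers-or-gap c<d λ where
              (inj₂ (d′ , c<d′ , d′<d)) → within-L∖b b<c c<d′ d′<d
              (inj₁ c⋖d) → cograph a b c d (covers⇒P4 a⋖b b⋖c c⋖d)
        where
        shrink : ∀ {x} → x ∈ L → length (remove x L) ≤ k
        shrink x∈L =
          ≤-pred (≤-trans (filter-notAll _ L (Any.map (λ x≡y y≢x → y≢x (sym x≡y)) x∈L)) |L|≤1+k)

        within-L∖c : ∀ {b′ c′} → a < b′ → b′ < c′ → c′ < c → ⊥
        within-L∖c = no-4-chain-within k (remove c L) (shrink (⊆L (<-trans a<b b<c) c<d))
          λ a<w w<c → ∈-filter⁺ _ (⊆L a<w (<-trans w<c c<d)) (proj₂ w<c)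

        within-L∖b : ∀ {c′ d′} → b < c′ → c′ < d′ → d′ < d → ⊥
        within-L∖b = no-4-chain-within k (remove b L) (shrink (⊆L a<b (<-trans b<c c<d)))
          λ b<w w<d → ∈-filter⁺ _ (⊆L (<-trans a<b b<w) w<d) (proj₂ b<w ∘ sym)

    no-4-chain : a < b → b < c → c < d → ⊥
    no-4-chain = no-4-chain-within _ (allFin m) ≤-refl (λ {w} _ _ → ∈-allFin w)

    between⇒¬separated : a < w → w < b → ¬ Separated w z
    between⇒¬separated a<w w<b (inj₁ (u , w<u , u<z)) = no-4-chain a<w w<u u<z
    between⇒¬separated a<w w<b (inj₂ (u , z<u , u<w)) = no-4-chain z<u u<w w<b

    private
      ¬gap-< : Gap a b → ¬ b < c
      ¬gap-< (_ , a<u , u<b) = no-4-chain a<u u<b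

      ¬<-gap : a < b → ¬ Gap b c
      ¬<-gap a<b (_ , b<u , u<c) = no-4-chain a<b b<u u<c

    ¬separated-triangle : Separated u v → Separated v w → Separated u w → ⊥
    ¬separated-triangle (inj₁ uv) (inj₁ vw) _          = ¬gap-< uv (gap⇒< vw)
    ¬separated-triangle (inj₁ uv) (inj₂ wv) (inj₁ uw)  = ¬<-gap (gap⇒< uw) wv
    ¬separated-triangle (inj₁ uv) (inj₂ wv) (inj₂ wu)  = ¬<-gap (gap⇒< wu) uv
    ¬separated-triangle (inj₂ vu) (inj₁ vw) (inj₁ uw)  = ¬gap-< vu (gap⇒< uw)
    ¬separated-triangle (inj₂ vu) (inj₁ vw) (inj₂ wu)  = ¬gap-< vw (gap⇒< wu)
    ¬separated-triangle (inj₂ vu) (inj₂ wv) _          = ¬gap-< wv (gap⇒< vu)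

open Order using (ciGraph)

module Pullback {n m : ℕ} (P : FinPoset m) (f : Fin n ⤖ Fin m) where
  open Bijection f using (to; injective; strictlySurjective)
  open FinPoset P using (_≤ₚ_; isPartialOrder)
  open IsPartialOrder isPartialOrder using (antisym) renaming (refl to ≤ₚ-refl; trans to ≤ₚ-trans)

  pullback : FinPoset n
  pullback = record
    { _≤ₚ_           = λ x y → to x ≤ₚ to y
    ; isPartialOrder = record
      { isPreorder = record
        { isEquivalence = isEquivalence
        ; reflexive     = λ { refl → ≤ₚ-refl }
        ; trans         = ≤ₚ-trans
        }
      ; antisym = λ x≤y y≤x → injective (antisym x≤y y≤x)
      }
    }

  private
    variable x y : Fin n
    module P = Order P
    module Q = Order pullback

    <-to : x Q.< y → to x P.< to y
    <-to (x≤y , x≢y) = x≤y , x≢y ∘ injective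

    <-from : to x P.< to y → x Q.< y
    <-from (x≤y , x≢y) = x≤y , x≢y ∘ cong to

    gap-from : P.Gap (to x) (to y) → Q.Gap x y
    gap-from (v , x<v , v<y) with strictlySurjective v
    ... | w , refl = w , <-from x<v , <-from v<y

    gap-to : Q.Gap x y → P.Gap (to x) (to y)
    gap-to (w , x<w , w<y) = to w , <-to x<w , <-to w<y

    covers-to : Covers pullback x y → Covers P (to x) (to y)
    covers-to (x<y , ¬gap) = <-to x<y , ¬gap ∘ gap-from

    covers-from : Covers P (to x) (to y) → Covers pullback x y
    covers-from (x<y , ¬gap) = <-from x<y , ¬gap ∘ gap-to

  CIEdge-pullback⁻ : CIEdge pullback x y → CIEdge P (to x) (to y)
  CIEdge-pullback⁻ = ⊎-map covers-to (⊎-map covers-to id)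

  CIEdge-pullback⁺ : CIEdge P (to x) (to y) → CIEdge pullback x y
  CIEdge-pullback⁺ = ⊎-map covers-from (⊎-map covers-from id)

module _ {n : ℕ} where
  private variable x : Fin n

  SameEdges : Graph n → Graph n → Set
  SameEdges G H = ∀ {x y} → (Graph.Adj G x y → Graph.Adj H x y) × (Graph.Adj H x y → Graph.Adj G x y)

  ciGraph-on-vertices : (G : Graph n) → IsCIGraph G → ∃ λ (Q : FinPoset n) → SameEdges G (ciGraph Q)
  ciGraph-on-vertices G (_ , P , f , adj⇔edge) =
    pullback ,
    λ {x} {y} → CIEdge-pullback⁺ ∘ proj₁ (adj⇔edge x y) , proj₂ (adj⇔edge x y) ∘ CIEdge-pullback⁻
    where open Pullback P f

  module _ {G H : Graph n} (same : SameEdges G H) where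

    IsCograph-resp : IsCograph G → IsCograph H
    IsCograph-resp cograph a b c d
      (a≢b , a≢c , a≢d , b≢c , b≢d , c≢d , ab , bc , cd , ¬ac , ¬bd , ¬ad) =
      cograph a b c d
        ( a≢b , a≢c , a≢d , b≢c , b≢d , c≢d
        , proj₂ same ab , proj₂ same bc , proj₂ same cd
        , ¬ac ∘ proj₁ same , ¬bd ∘ proj₁ same , ¬ad ∘ proj₁ same )

    IsCotreeOf-resp : ∀ {T} → IsCotreeOf G T → IsCotreeOf H T
    IsCotreeOf-resp (shape , unique , complete , adj⇔lca) =
      shape , unique , complete ,
      λ x y x≢y → let adj⇒lca , lca⇒adj = adj⇔lca x y x≢y in adj⇒lca ∘ proj₂ same , proj₁ same ∘ lca⇒adj

  cotree-of-ciGraph : (G : Graph n) → IsCIGraph G → IsCograph G → ∀ {T} → IsCotreeOf G T →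
    ∃ λ (Q : FinPoset n) → IsCograph (ciGraph Q) × IsCotreeOf (ciGraph Q) T
  cotree-of-ciGraph G ci cograph cotree with ciGraph-on-vertices G ci
  ... | Q , same = Q , IsCograph-resp {G} {ciGraph Q} same cograph , IsCotreeOf-resp {G} {ciGraph Q} same cotree

  leaf-cotree⇒complete : (G : Graph n) → IsCotreeOf G (leaf x) → IsComplete G
  leaf-cotree⇒complete {x} G (_ , _ , complete , _) y z y≢z = ⊥-elim (y≢z (trans (only y) (sym (only z))))
    where
    only : ∀ y → y ≡ x
    only y with complete y
    ... | here y≡x = y≡x

module _ {A : Set} where
  private variable
    x y : A
    b c : Bool
    s t u : Tree A
    ts : List (Tree A)

  ∈-leavesL⁺ : t ∈ ts → x ∈ leaves t → x ∈ leavesL ts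
  ∈-leavesL⁺ (here refl) x∈t = ∈-++⁺ˡ x∈t
  ∈-leavesL⁺ {ts = u ∷ _} (there t∈ts) x∈t = ∈-++⁺ʳ (leaves u) (∈-leavesL⁺ t∈ts x∈t)

  ∈-leavesL⁻ : ∀ ts → x ∈ leavesL ts → ∃ λ t → t ∈ ts × x ∈ leaves t
  ∈-leavesL⁻ (t ∷ ts) x∈ with ∈-++⁻ (leaves t) x∈
  ... | inj₁ x∈t = t , here refl , x∈t
  ... | inj₂ x∈ts with ∈-leavesL⁻ ts x∈ts
  ...   | u , u∈ts , x∈u = u , there u∈ts , x∈u

  ∈⇒lookup : t ∈ ts → ∃ λ i → t ≡ lookup ts i
  ∈⇒lookup t∈ts = Any.index t∈ts , lookup-index t∈ts

  ⊑-trans : s ⊑ t → t ⊑ u → s ⊑ u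
  ⊑-trans s⊑t self = s⊑t
  ⊑-trans s⊑t (child u∈us t⊑u) = child u∈us (⊑-trans s⊑t t⊑u)

  Unique-++⁻ : ∀ xs {ys : List A} → Unique (xs ++ ys) → Unique xs × Unique ys × Disjoint xs ys
  Unique-++⁻ [] unique = [] , unique , λ ()
  Unique-++⁻ (x ∷ xs) (x∉ ∷ unique) with Unique-++⁻ xs unique
  ... | unique-xs , unique-ys , disjoint = ++⁻ˡ xs x∉ ∷ unique-xs , unique-ys , λ where
    (here refl , x∈ys)   → All.lookup (++⁻ʳ xs x∉) x∈ys refl
    (there y∈xs , y∈ys) → disjoint (y∈xs , y∈ys)

  Unique-child : ∀ (ts : List (Tree A)) (i : Fin (length ts)) →
    Unique (leavesL ts) → Unique (leaves (lookup ts i))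
  Unique-child (t ∷ _) zero unique = proj₁ (Unique-++⁻ (leaves t) unique)
  Unique-child (t ∷ ts) (suc i) unique = Unique-child ts i (proj₁ (proj₂ (Unique-++⁻ (leaves t) unique)))

  leaf-determines-child : ∀ (ts : List (Tree A)) {i j} → Unique (leavesL ts) →
    x ∈ leaves (lookup ts i) → x ∈ leaves (lookup ts j) → i ≡ j
  leaf-determines-child (t ∷ ts) {i} {j} unique x∈i x∈j with Unique-++⁻ (leaves t) unique | i | j
  ... | _ , _ , _ | zero | zero = refl
  ... | _ , _ , disjoint | zero | suc j = ⊥-elim (disjoint (x∈i , ∈-leavesL⁺ (∈-lookup {xs = ts} j) x∈j))
  ... | _ , _ , disjoint | suc i | zero = ⊥-elim (disjoint (x∈j , ∈-leavesL⁺ (∈-lookup {xs = ts} i) x∈i))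
  ... | _ , unique-ts , _ | suc i | suc j = cong suc (leaf-determines-child ts unique-ts x∈i x∈j)

  LCA-leaves : LCA x y t b → x ∈ leaves t × y ∈ leaves t
  LCA-leaves {t = node _ ts} (here i j _ x∈i y∈j) =
    ∈-leavesL⁺ (∈-lookup {xs = ts} i) x∈i , ∈-leavesL⁺ (∈-lookup {xs = ts} j) y∈j
  LCA-leaves {t = node _ ts} (there i lca) with LCA-leaves lca
  ... | x∈ , y∈ = ∈-leavesL⁺ (∈-lookup {xs = ts} i) x∈ , ∈-leavesL⁺ (∈-lookup {xs = ts} i) y∈

  LCA-distinct : Unique (leaves t) → LCA x y t b → x ≢ y
  LCA-distinct {t = node _ ts} unique (here i j i≢j x∈i y∈j) refl =
    i≢j (leaf-determines-child ts unique x∈i y∈j)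
  LCA-distinct {t = node _ ts} unique (there i lca) = LCA-distinct (Unique-child ts i unique) lca

  LCA-label-unique : Unique (leaves t) → LCA x y t b → LCA x y t c → b ≡ c
  LCA-label-unique _ (here _ _ _ _ _) (here _ _ _ _ _) = refl
  LCA-label-unique {t = node _ ts} unique (here i j i≢j x∈i y∈j) (there k lca) =
    ⊥-elim (split-below unique i≢j x∈i y∈j lca)
    where
    split-below : ∀ {i j k} → Unique (leavesL ts) → i ≢ j → x ∈ leaves (lookup ts i) →
                  y ∈ leaves (lookup ts j) → LCA x y (lookup ts k) c → ⊥
    split-below unique i≢j x∈i y∈j lca with LCA-leaves lca
    ... | x∈k , y∈k = i≢j (trans (leaf-determines-child ts unique x∈i x∈k)
                                 (sym (leaf-determines-child ts unique y∈j y∈k)))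
  LCA-label-unique unique lca@(there _ _) lca′@(here _ _ _ _ _) = sym (LCA-label-unique unique lca′ lca)
  LCA-label-unique {t = node _ ts} unique (there k lca) (there k′ lca′)
    with leaf-determines-child ts unique (proj₁ (LCA-leaves lca)) (proj₁ (LCA-leaves lca′))
  ... | refl = LCA-label-unique (Unique-child ts k unique) lca lca′

  LCA-⊑ : s ⊑ t → LCA x y s b → LCA x y t b
  LCA-⊑ self lca = lca
  LCA-⊑ (child u∈us s⊑u) lca with ∈⇒lookup u∈us
  ... | i , refl = there i (LCA-⊑ s⊑u lca)

  children-shaped : CotreeShape (node b ts) → All CotreeShape ts
  children-shaped (node _ shapes _) = shapes

  children-alternate : CotreeShape (node b ts) → All (AltChild b) ts
  children-alternate (node _ _ alternate) = alternate

  AltChild⇒leaf-or-node : AltChild b t → IsLeaf t ⊎ IsNodeWith (not b) t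
  AltChild⇒leaf-or-node {t = leaf _} _ = inj₁ tt
  AltChild⇒leaf-or-node {t = node _ _} c≡¬b = inj₂ c≡¬b

  CotreeShape-⊑ : s ⊑ t → CotreeShape t → CotreeShape s
  CotreeShape-⊑ self shape = shape
  CotreeShape-⊑ (child u∈us s⊑u) shape = CotreeShape-⊑ s⊑u (All.lookup (children-shaped shape) u∈us)

  leaves-nonempty : CotreeShape t → ∃ λ x → x ∈ leaves t
  leaves-nonempty leaf = _ , here refl
  leaves-nonempty (node {ts = []} () _ _)
  leaves-nonempty (node {ts = _ ∷ _} _ (shape ∷ _) _) with leaves-nonempty shape
  ... | x , x∈ = x , ∈-++⁺ˡ x∈

  private
    other-index : ∀ (ts : List (Tree A)) → 2 ≤ length ts → (i : Fin (length ts)) → ∃ λ j → i ≢ j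
    other-index (_ ∷ []) (s≤s ()) _
    other-index (_ ∷ _ ∷ _) _ zero    = suc zero , λ ()
    other-index (_ ∷ _ ∷ _) _ (suc _) = zero , λ ()

  separating-leaf : CotreeShape (node b ts) → t ∈ ts →
    ∃ λ z → ∀ {x} → x ∈ leaves t → LCA x z (node b ts) b
  separating-leaf {ts = ts} (node 2≤|ts| shapes _) t∈ts with ∈⇒lookup t∈ts
  ... | i , refl with other-index ts 2≤|ts| i
  ...   | j , i≢j with leaves-nonempty (All.lookup shapes (∈-lookup {xs = ts} j))
  ...     | z , z∈j = z , λ x∈i → here i j i≢j x∈i z∈j

  LCA-partner : CotreeShape t → IsNodeWith b t → x ∈ leaves t → ∃ λ z → LCA x z t b
  LCA-partner {t = node _ ts} shape refl x∈t with ∈-leavesL⁻ ts x∈t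
  ... | u , u∈ts , x∈u with separating-leaf shape u∈ts
  ...   | z , separated = z , separated x∈u

  node-LCA : CotreeShape t → IsNodeWith b t → ∃₂ λ x y → LCA x y t b
  node-LCA shape is-b with leaves-nonempty shape
  ... | x , x∈ = x , LCA-partner shape is-b x∈

  ⊏-parent : s ⊏ t → ∃₂ λ c qs → node c qs ⊑ t × s ∈ qs
  ⊏-parent (child t∈ts s⊑t) = parent t∈ts s⊑t
    where
    parent : t ∈ ts → s ⊑ t → ∃₂ λ c qs → node c qs ⊑ node b ts × s ∈ qs
    parent {ts = ts} {b = b} t∈ts self = b , ts , self , t∈ts
    parent t∈ts (child u∈us s⊑u) with parent u∈us s⊑u
    ... | c , qs , q⊑u , s∈qs = c , qs , child t∈ts q⊑u , s∈qs

  zero-child : ∀ (ts : List (Tree A)) → Fin (numZeroNodes ts) → Fin (length ts)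
  zero-child (leaf _ ∷ ts) i = suc (zero-child ts i)
  zero-child (node false _ ∷ ts) zero = zero
  zero-child (node false _ ∷ ts) (suc i) = suc (zero-child ts i)
  zero-child (node true _ ∷ ts) i = suc (zero-child ts i)

  zero-child-is-0-node : ∀ (ts : List (Tree A)) i → IsNodeWith false (lookup ts (zero-child ts i))
  zero-child-is-0-node (leaf _ ∷ ts) i = zero-child-is-0-node ts i
  zero-child-is-0-node (node false _ ∷ ts) zero = refl
  zero-child-is-0-node (node false _ ∷ ts) (suc i) = zero-child-is-0-node ts i
  zero-child-is-0-node (node true _ ∷ ts) i = zero-child-is-0-node ts i

  zero-child-injective : ∀ (ts : List (Tree A)) → Injective _≡_ _≡_ (zero-child ts)
  zero-child-injective (leaf _ ∷ ts) e = zero-child-injective ts (suc-injective e)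
  zero-child-injective (node false _ ∷ ts) {zero} {zero} _ = refl
  zero-child-injective (node false _ ∷ ts) {suc _} {suc _} e =
    cong suc (zero-child-injective ts (suc-injective e))
  zero-child-injective (node true _ ∷ ts) e = zero-child-injective ts (suc-injective e)

  leaf-rank : leaf x ∈ ts → Fin (numLeaves ts)
  leaf-rank {ts = leaf _ ∷ _} (here _) = zero
  leaf-rank {ts = leaf _ ∷ _} (there p) = suc (leaf-rank p)
  leaf-rank {ts = node _ _ ∷ _} (there p) = leaf-rank p

  leaf-rank-injective : (p : leaf x ∈ ts) (q : leaf y ∈ ts) → leaf-rank p ≡ leaf-rank q → x ≡ y
  leaf-rank-injective {ts = leaf _ ∷ _} (here refl) (here refl) _ = refl
  leaf-rank-injective {ts = leaf _ ∷ _} (there p) (there q) e = leaf-rank-injective p q (suc-injective e)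
  leaf-rank-injective {ts = node _ _ ∷ _} (there p) (there q) e = leaf-rank-injective p q e

  injection⇒≤numLeaves : ∀ {k} (g : Fin k → ∃ λ x → leaf x ∈ ts) →
    Injective _≡_ _≡_ (proj₁ ∘ g) → k ≤ numLeaves ts
  injection⇒≤numLeaves g injective = injective⇒≤ {f = leaf-rank ∘ proj₂ ∘ g} λ {i} {j} e →
    injective (leaf-rank-injective (proj₂ (g i)) (proj₂ (g j)) e)

module CICotree {n : ℕ} (Q : FinPoset n) (cograph : IsCograph (ciGraph Q)) where
  open Order Q hiding (ciGraph)
  open Cograph cograph

  private variable
    a b w x y z : Fin n
    cs ts : List (Tree (Fin n))

  module Cotree {T : Tree (Fin n)} (cotree : IsCotreeOf (ciGraph Q) T) where
    shape : CotreeShape T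
    shape = proj₁ cotree

    vertex∈leaves : ∀ x → x ∈ leaves T
    vertex∈leaves = proj₁ (proj₂ (proj₂ cotree))

    private
      unique : Unique (leaves T)
      unique = proj₁ (proj₂ cotree)

      edge⇔LCA₁ : ∀ x y → x ≢ y →
        (CIEdge Q x y → LCA x y T true) × (LCA x y T true → CIEdge Q x y)
      edge⇔LCA₁ = proj₂ (proj₂ (proj₂ cotree))

    LCA₁⇒CIEdge : LCA x y T true → CIEdge Q x y
    LCA₁⇒CIEdge lca = proj₂ (edge⇔LCA₁ _ _ (LCA-distinct unique lca)) lca

    LCA₀⇒¬CIEdge : LCA x y T false → ¬ CIEdge Q x y
    LCA₀⇒¬CIEdge lca edge =
      case LCA-label-unique unique (proj₁ (edge⇔LCA₁ _ _ (LCA-distinct unique lca)) edge) lca of λ ()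

    LCA₀⇒separated : LCA x y T false → ¬ ¬ Separated x y
    LCA₀⇒separated lca = ¬CIEdge⇒separated (LCA-distinct unique lca) (LCA₀⇒¬CIEdge lca)

    ¬LCA₀-triangle : LCA x y T false → LCA y z T false → LCA x z T false → ⊥
    ¬LCA₀-triangle xy yz xz =
      LCA₀⇒separated xy λ xy → LCA₀⇒separated yz λ yz → LCA₀⇒separated xz λ xz →
      ¬separated-triangle xy yz xz

    between⇒¬LCA₀ : a < w → w < b → ¬ LCA w z T false
    between⇒¬LCA₀ a<w w<b lca = LCA₀⇒separated lca (between⇒¬separated a<w w<b)

    0-node-binary : ∀ cs → node false cs ⊑ T → length cs ≡ 2
    0-node-binary (_ ∷ _ ∷ []) _ = refl
    0-node-binary [] q⊑T with CotreeShape-⊑ q⊑T shape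
    ... | node () _ _
    0-node-binary (_ ∷ []) q⊑T with CotreeShape-⊑ q⊑T shape
    ... | node (s≤s ()) _ _
    0-node-binary (_ ∷ _ ∷ _ ∷ _) q⊑T with CotreeShape-⊑ q⊑T shape
    ... | node _ (shape₀ ∷ shape₁ ∷ shape₂ ∷ _) _
      with leaves-nonempty shape₀ | leaves-nonempty shape₁ | leaves-nonempty shape₂
    ... | x , x∈ | y , y∈ | z , z∈ = ⊥-elim
      (¬LCA₀-triangle (LCA-⊑ q⊑T (here zero (suc zero) (λ ()) x∈ y∈))
                      (LCA-⊑ q⊑T (here (suc zero) (suc (suc zero)) (λ ()) y∈ z∈))
                      (LCA-⊑ q⊑T (here zero (suc (suc zero)) (λ ()) x∈ z∈)))

    0-node-children : node false cs ⊑ T → All (λ t → IsLeaf t ⊎ IsNodeWith true t) cs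
    0-node-children q⊑T = All.map AltChild⇒leaf-or-node (children-alternate (CotreeShape-⊑ q⊑T shape))

    inner-1-node-leaves : node true cs ⊏ T → All IsLeaf cs
    inner-1-node-leaves {cs} s⊏T with ⊏-parent s⊏T
    ... | true , qs , q⊑T , s∈qs =
      case All.lookup (children-alternate (CotreeShape-⊑ q⊑T shape)) s∈qs of λ ()
    ... | false , qs , q⊑T , s∈qs with separating-leaf (CotreeShape-⊑ q⊑T shape) s∈qs
    ...   | z , LCA-z = All.tabulate leaf-child
      where
      s-shape : CotreeShape (node true cs)
      s-shape = CotreeShape-⊑ (child s∈qs self) (CotreeShape-⊑ q⊑T shape)

      leaf-child : ∀ {r} → r ∈ cs → IsLeaf r
      leaf-child {leaf _} _ = tt
      leaf-child {node _ _} r∈cs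
        with node-LCA (All.lookup (children-shaped s-shape) r∈cs)
                      (All.lookup (children-alternate s-shape) r∈cs)
      ... | x , y , LCA-xy with LCA-leaves LCA-xy
      ...   | x∈r , y∈r =
        ¬LCA₀-triangle (LCA-⊑ (⊑-trans (child s∈qs (child r∈cs self)) q⊑T) LCA-xy)
                       (LCA-⊑ q⊑T (LCA-z (∈-leavesL⁺ r∈cs y∈r)))
                       (LCA-⊑ q⊑T (LCA-z (∈-leavesL⁺ r∈cs x∈r)))

  -- Below a 0-root every vertex has a non-neighbour, which a middle vertex cannot have.
  root≢0 : ¬ IsCotreeOf (ciGraph Q) (node false ts)
  root≢0 cotree with node-LCA (Cotree.shape cotree) refl
  ... | x , y , lca = LCA₀⇒separated lca λ where
      (inj₁ (_ , x<w , w<y)) → no-middle x<w w<y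
      (inj₂ (_ , y<w , w<x)) → no-middle y<w w<x
    where
    open Cotree cotree
    no-middle : a < w → w < b → ⊥
    no-middle {w = w} a<w w<b = between⇒¬LCA₀ a<w w<b (proj₂ (LCA-partner shape refl (vertex∈leaves w)))

  module Root₁ {ts} (cotree : IsCotreeOf (ciGraph Q) (node true ts)) where
    open Cotree cotree public

    record Straddle (c : Fin (length ts)) : Set where
      constructor straddle
      field
        {low middle high} : Fin n
        low∈        : low ∈ leaves (lookup ts c)
        high∈       : high ∈ leaves (lookup ts c)
        low<middle  : low < middle
        middle<high : middle < high
    open Straddle

    0-child-straddled : ∀ c → IsNodeWith false (lookup ts c) → ¬ ¬ Straddle c
    0-child-straddled c is0 with node-LCA (All.lookup (children-shaped shape) (∈-lookup {xs = ts} c)) is0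
    ... | x , y , lca with LCA-leaves lca
    ...   | x∈ , y∈ = ¬¬-map straddle-of (LCA₀⇒separated (there c lca))
      where
      straddle-of : Separated x y → Straddle c
      straddle-of (inj₁ (_ , x<w , w<y)) = straddle x∈ y∈ x<w w<y
      straddle-of (inj₂ (_ , y<w , w<x)) = straddle y∈ x∈ y<w w<x

    between⇒leaf-child : a < w → w < b → leaf w ∈ ts
    between⇒leaf-child {w = w} a<w w<b with ∈-leavesL⁻ ts (vertex∈leaves w)
    ... | t , t∈ts , w∈t = classify t∈ts w∈t (All.lookup (children-alternate shape) t∈ts)
      where
      classify : ∀ {t} → t ∈ ts → w ∈ leaves t → AltChild true t → leaf w ∈ ts
      classify {leaf _} t∈ts (here refl) _ = t∈ts
      classify {node false _} t∈ts w∈t refl = ⊥-elim (between⇒¬LCA₀ a<w w<b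
        (LCA-⊑ (child t∈ts self) (proj₂ (LCA-partner (All.lookup (children-shaped shape) t∈ts) refl w∈t))))

    -- Leaves of distinct children of the 1-root are adjacent, while a shared
    -- middle would separate them.
    straddle-middle-injective : ∀ {c c′} (s : Straddle c) (s′ : Straddle c′) →
      middle s ≡ middle s′ → c ≡ c′
    straddle-middle-injective {c} {c′} s s′ refl with c ≟ c′
    ... | yes c≡c′ = c≡c′
    ... | no c≢c′ = ⊥-elim (gap⇒¬CIEdge (_ , low<middle s , middle<high s′)
                                         (LCA₁⇒CIEdge (here c c′ c≢c′ (low∈ s) (high∈ s′))))

    -- The straddles only exist up to double negation (the order is not
    -- decidable), which the decidable conclusion absorbs.
    numZeroNodes≤numLeaves : numZeroNodes ts ≤ numLeaves ts
    numZeroNodes≤numLeaves = decidable-stable (numZeroNodes ts ≤? numLeaves ts)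
      (¬¬-map count (sequence rawApplicative λ i →
        0-child-straddled (zero-child ts i) (zero-child-is-0-node ts i)))
      where
      open RawMonad ¬¬-Monad using (rawApplicative)
      count : (∀ i → Straddle (zero-child ts i)) → numZeroNodes ts ≤ numLeaves ts
      count straddles = injection⇒≤numLeaves leaf-of injective
        where
        leaf-of : Fin (numZeroNodes ts) → ∃ λ w → leaf w ∈ ts
        leaf-of i = _ , between⇒leaf-child (low<middle (straddles i)) (middle<high (straddles i))
        injective : Injective _≡_ _≡_ (proj₁ ∘ leaf-of)
        injective e = zero-child-injective ts (straddle-middle-injective (straddles _) (straddles _) e)

    root-children : All (λ t → IsLeaf t ⊎ IsNodeWith false t) ts
    root-children = All.map AltChild⇒leaf-or-node (children-alternate shape)

    root-children-in-TC : All (λ t → IsLeaf t ⊎ Good0 t) ts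
    root-children-in-TC = All.tabulate in-TC
      where
      grandchild : ∀ {cs t} → node false cs ∈ ts → t ∈ cs → LeafOrLeafy1 t
      grandchild {t = leaf _} _ _ = tt
      grandchild {t = node true _} q∈ts t∈cs = inner-1-node-leaves (child q∈ts (child t∈cs self))
      grandchild {t = node false _} q∈ts t∈cs =
        case All.lookup (children-alternate (All.lookup (children-shaped shape) q∈ts)) t∈cs of λ ()

      in-TC : ∀ {t} → t ∈ ts → IsLeaf t ⊎ Good0 t
      in-TC {leaf _} _ = inj₁ tt
      in-TC {node true _} t∈ts = case All.lookup (children-alternate shape) t∈ts of λ ()
      in-TC {node false (_ ∷ _ ∷ [])} t∈ts =
        inj₂ (grandchild t∈ts (here refl) , grandchild t∈ts (there (here refl)))
      in-TC {node false []} t∈ts = case 0-node-binary _ (child t∈ts self) of λ ()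
      in-TC {node false (_ ∷ [])} t∈ts = case 0-node-binary _ (child t∈ts self) of λ ()
      in-TC {node false (_ ∷ _ ∷ _ ∷ _)} t∈ts = case 0-node-binary _ (child t∈ts self) of λ ()

lemma4p7 : ∀ {n : ℕ} (G : Graph n) (T : Tree (Fin n)) →
    IsCograph G → IsCIGraph G → ¬ IsComplete G → IsCotreeOf G T →
    (Σ (List (Tree (Fin n))) λ ts → (T ≡ node true ts) ×
        All (λ t → IsLeaf t ⊎ IsNodeWith false t) ts × (numZeroNodes ts ≤ numLeaves ts))
    × (∀ s → s ⊑ T → ∀ cs → s ≡ node false cs →
        (length cs ≡ 2) × All (λ t → IsLeaf t ⊎ IsNodeWith true t) cs)
    × (∀ s → s ⊏ T → ∀ cs → s ≡ node true cs → All IsLeaf cs)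
    × InTC T
lemma4p7 G (leaf _) _ _ ¬complete cotree = ⊥-elim (¬complete (leaf-cotree⇒complete G cotree))
lemma4p7 G (node false ts) cograph ci _ cotree with cotree-of-ciGraph G ci cograph cotree
... | Q , cographQ , cotreeQ = ⊥-elim (CICotree.root≢0 Q cographQ cotreeQ)
lemma4p7 G (node true ts) cograph ci _ cotree with cotree-of-ciGraph G ci cograph cotree
... | Q , cographQ , cotreeQ =
  (ts , refl , root-children , numZeroNodes≤numLeaves) ,
  (λ { _ q⊑T cs refl → 0-node-binary cs q⊑T , 0-node-children q⊑T }) ,
  (λ { _ s⊏T _ refl → inner-1-node-leaves s⊏T }) ,
  (root-children-in-TC , numZeroNodes≤numLeaves)
  where open CICotree.Root₁ Q cographQ cotreeQ
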